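{- The equal substring relation $R_{\mathsf{eq}}$, consisting of all $(x_o,x_c,y_o,y_c)\in D^4$ such that $w[x_o,x_c]=w[y_o,y_c]$, $x_c<y_o$, and $w(z)\neq\varepsilon$ for all $z\in\{x_o,x_c,y_o,y_c\}$, can be maintained in $\mathsf{DynCQ}$.
   Context: Dynamic setting. Fix a finite alphabet $\Sigma$. A word-structure has domain $D=\{1,\dots,n+1\}$ ($n\ge0$), the linear order $<$, a constant $\$=n+1$, and for each $\zeta\in\Sigma$ a unary relation $R_\zeta\subseteq\{1,\dots,n\}$, each position in at most one $R_\zeta$. Write $w(i)=\zeta$ if $R_\zeta(i)$ and $w(i)=\varepsilon$ otherwise; the word is $w=w(1)\cdots w(n)$, and for $i\le j$ in $D$, $w[i,j]=w(i)w(i+1)\cdots w(j)$. Updates $\mathsf{ins}_\zeta(i)$ (set $w(i)=\zeta$) and $\mathsf{reset}(i)$ (set $w(i)=\varepsilon$), $i\le n$, are allowed only if they change the word-structure; initially all positions are $\varepsilon$. A dynamic program has finitely many auxiliary relations over $D$, initialized by first-order formulas, and for each auxiliary relation $R$ (arity $k$) and each abstract update $\mathsf{op}$ an update formula $\varphi^R_{\mathsf{op}}(y;x_1,\dots,x_k)$; after applying $\mathsf{op}$ at $i$, the new $R$ is the set of $\vec j$ with $\varphi^R_{\mathsf{op}}(i;\vec j)$ true in the updated word-structure with the old auxiliary relations. A program maintains a relation if a designated auxiliary relation equals it after every sequence of updates. $\mathsf{DynCQ}$: all update formulas are conjunctive queries (built from atoms by conjunction and existential quantification). -}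

module Defs where

open import Data.Nat using (ℕ; zero; suc)
open import Data.Fin using (Fin; zero; suc; fromℕ; inject₁; _≤_; _<_)
open import Data.Fin.Properties using (_≟_; _≤?_; _<?_)
open import Data.Bool using (Bool; true; false; _∧_; _∨_; not; if_then_else_)
open import Data.Maybe using (Maybe; just; nothing)
open import Data.List using (List; mapMaybe; allFin)
open import Data.Product using (_×_)
open import Relation.Nullary using (does; ¬_)
open import Relation.Binary.PropositionalEquality using (_≡_; _≢_; subst; sym)
open import Function.Bundles using (_⇔_)

-- Domain D = {1,…,n+1} is
-- represented by Fin (suc n) (element p stands for p+1); the constant $
-- is the largest element fromℕ n.  A word is a function from the n
-- word positions (Fin n; position i ↦ domain element inject₁ i) to
-- Maybe (Fin k), where nothing = ε.

D : ℕ → Set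
D n = Fin (suc n)

Word : ℕ → ℕ → Set
Word k n = Fin n → Maybe (Fin k)

emptyWord : ∀ {k n} → Word k n
emptyWord _ = nothing

-- w(p) for a domain element p (ε at $): at w (inject₁ i) = w i, at w $ = ε
at : ∀ {k n} → Word k n → D n → Maybe (Fin k)
at {n = zero}  w _       = nothing
at {n = suc n} w zero    = w zero
at {n = suc n} w (suc p) = at (λ j → w (suc j)) p

-- w[i,j] = w(i) w(i+1) ⋯ w(j)  (ε letters vanish)
substr : ∀ {k n} → Word k n → D n → D n → List (Fin k)
substr {n = n} w i j =
  mapMaybe (λ p → if does (i ≤? p) ∧ does (p ≤? j) then at w p else nothing)
           (allFin (suc n))

setW : ∀ {k n} → Word k n → Fin n → Maybe (Fin k) → Word k n
setW w i x j = if does (j ≟ i) then x else w j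

data Term (m : ℕ) : Set where
  var    : Fin m → Term m
  dollar : Term m

data Atom (k : ℕ) {a : ℕ} (ar : Fin a → ℕ) (m : ℕ) : Set where
  lt     : Term m → Term m → Atom k ar m
  eq     : Term m → Term m → Atom k ar m
  letter : Fin k → Term m → Atom k ar m
  rel    : (r : Fin a) → (Fin (ar r) → Term m) → Atom k ar m

data CQ (k : ℕ) {a : ℕ} (ar : Fin a → ℕ) : ℕ → Set where
  atom : ∀ {m} → Atom k ar m → CQ k ar m
  tt   : ∀ {m} → CQ k ar m
  and  : ∀ {m} → CQ k ar m → CQ k ar m → CQ k ar m
  ex   : ∀ {m} → CQ k ar (suc m) → CQ k ar m

data FO (k : ℕ) {a : ℕ} (ar : Fin a → ℕ) : ℕ → Set where
  atom : ∀ {m} → Atom k ar m → FO k ar m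
  tt   : ∀ {m} → FO k ar m
  neg  : ∀ {m} → FO k ar m → FO k ar m
  and  : ∀ {m} → FO k ar m → FO k ar m → FO k ar m
  or   : ∀ {m} → FO k ar m → FO k ar m → FO k ar m
  ex   : ∀ {m} → FO k ar (suc m) → FO k ar m
  all  : ∀ {m} → FO k ar (suc m) → FO k ar m

noAux : Fin 0 → ℕ
noAux ()

anyFin : ∀ {m} → (Fin m → Bool) → Bool
anyFin {zero}  f = false
anyFin {suc m} f = f zero ∨ anyFin (λ i → f (suc i))

allFin? : ∀ {m} → (Fin m → Bool) → Bool
allFin? {zero}  f = true
allFin? {suc m} f = f zero ∧ allFin? (λ i → f (suc i))

cons : ∀ {A : Set} {m} → A → (Fin m → A) → Fin (suc m) → A
cons x ν zero    = x
cons x ν (suc i) = ν i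

AuxState : ∀ {a} → (Fin a → ℕ) → ℕ → Set
AuxState {a} ar n = (r : Fin a) → (Fin (ar r) → D n) → Bool

isLetter : ∀ {k} → Maybe (Fin k) → Fin k → Bool
isLetter (just ζ′) ζ = does (ζ′ ≟ ζ)
isLetter nothing   ζ = false

module _ {k n a : ℕ} {ar : Fin a → ℕ} (w : Word k n) (A : AuxState ar n) where

  evalT : ∀ {m} → (Fin m → D n) → Term m → D n
  evalT ν (var i) = ν i
  evalT ν dollar  = fromℕ n

  evalA : ∀ {m} → (Fin m → D n) → Atom k ar m → Bool
  evalA ν (lt s t)     = does (evalT ν s <? evalT ν t)
  evalA ν (eq s t)     = does (evalT ν s ≟ evalT ν t)
  evalA ν (letter ζ t) = isLetter (at w (evalT ν t)) ζ
  evalA ν (rel r ts)   = A r (λ i → evalT ν (ts i))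

  evalCQ : ∀ {m} → (Fin m → D n) → CQ k ar m → Bool
  evalCQ ν (atom x)  = evalA ν x
  evalCQ ν tt        = true
  evalCQ ν (and φ ψ) = evalCQ ν φ ∧ evalCQ ν ψ
  evalCQ ν (ex φ)    = anyFin (λ d → evalCQ (cons d ν) φ)

  evalFO : ∀ {m} → (Fin m → D n) → FO k ar m → Bool
  evalFO ν (atom x)  = evalA ν x
  evalFO ν tt        = true
  evalFO ν (neg φ)   = not (evalFO ν φ)
  evalFO ν (and φ ψ) = evalFO ν φ ∧ evalFO ν ψ
  evalFO ν (or φ ψ)  = evalFO ν φ ∨ evalFO ν ψ
  evalFO ν (ex φ)    = anyFin (λ d → evalFO (cons d ν) φ)
  evalFO ν (all φ)   = allFin? (λ d → evalFO (cons d ν) φ)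

noAuxState : ∀ {n} → AuxState noAux n
noAuxState ()

data Op (k : ℕ) : Set where
  ins   : Fin k → Op k
  reset : Op k

newLetter : ∀ {k} → Op k → Maybe (Fin k)
newLetter (ins ζ) = just ζ
newLetter reset   = nothing

-- Update formula φ^R_op(y; x₁,…,x_r): variable zero is
-- y, variable suc j is x_{j+1}.

record DynCQProgram (k : ℕ) : Set where
  field
    a      : ℕ
    ar     : Fin a → ℕ
    init   : (r : Fin a) → FO k noAux (ar r)
    upd    : (r : Fin a) → Op k → CQ k ar (suc (ar r))
    out    : Fin a
    out-ar : ar out ≡ 4

module _ {k : ℕ} (P : DynCQProgram k) where
  open DynCQProgram P

  initAux : ∀ {n} → AuxState ar n
  initAux r t = evalFO emptyWord noAuxState t (init r)

  data Reachable (n : ℕ) : Word k n → AuxState ar n → Set where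
    start : Reachable n emptyWord initAux
    step  : ∀ {w A} → Reachable n w A → (op : Op k) (i : Fin n) →
            w i ≢ newLetter op →
            Reachable n (setW w i (newLetter op))
              (λ r t → evalCQ (setW w i (newLetter op)) A
                         (cons (inject₁ i) t) (upd r op))

  Maintains : (∀ {n} → Word k n → (Fin 4 → D n) → Set) → Set
  Maintains Rel = ∀ n (w : Word k n) (A : AuxState ar n) → Reachable n w A →
    (t : Fin 4 → D n) →
    (A out (subst (λ m → Fin m → D n) (sym out-ar) t) ≡ true) ⇔ Rel w t

Req : ∀ {k n} → Word k n → (Fin 4 → D n) → Set
Req w t =
  let xo = t (# 0) ; xc = t (# 1) ; yo = t (# 2) ; yc = t (# 3) in
  (xo ≤ xc) × (yo ≤ yc) × (substr w xo xc ≡ substr w yo yc) × (xc < yo) ×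
  (at w xo ≢ nothing) × (at w xc ≢ nothing) × (at w yo ≢ nothing) × (at w yc ≢ nothing)
  where open import Data.Fin using (#_)

-- Besides R_eq the program maintains F(a, b, c, d) :⇔ a ≤ b ≤ c ≤ d ∧ w[a, b) = w[c, d) for half-open
-- blocks, and the marked positions (those carrying a letter, and $).  An update at i only changes a
-- block containing i.  If i ∈ [a, b), the new w[a, b) is w[a, i) ζ w[i+1, b) (without ζ for a reset),
-- and it equals the untouched w[c, d) iff the latter splits at some j as w[c, j) ζ w[j+1, d): two
-- F-atoms of the old word plus a letter atom.  Whether i lies in the left block, the right block or
-- neither is a disjunction, which a conjunctive query cannot express; it is delegated to static
-- relations, initialised by first-order formulas, that select the arguments of the two F-atoms.
-- R_eq(xo, xc, yo, yc) is then F(xo, xc+1, yo, yc+1) with marked endpoints and xc < yo.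

module Submission where

open import Defs
open import Data.Nat as ℕ using (ℕ; zero; suc; _+_; _∸_; _≤_; _<_; z≤n; s≤s)
open import Data.Nat.Properties
open import Data.Fin using (Fin; zero; suc; toℕ; fromℕ; fromℕ<; inject₁; #_; _↑ʳ_)
import Data.Fin.Properties as Finₚ
open import Data.Vec using (Vec; []; _∷_; lookup)
open import Data.Bool using (Bool; true; false; T; not; if_then_else_) renaming (_∧_ to _&&_)
open import Data.Bool.Properties using (T-∧; T-∨; T-≡)
open import Data.Maybe using (Maybe; just; nothing; maybe′)
open import Data.List using (List; []; _∷_; _++_; catMaybes; tabulate)
open import Data.List.Properties using (∷-injective; ++-identityʳ; map-tabulate)
open import Data.Product using (Σ; _×_; _,_; proj₁; proj₂)
open import Data.Product.Function.NonDependent.Propositional using (_×-⇔_)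
open import Data.Sum using (_⊎_; inj₁; inj₂; [_,_]′; map₂)
open import Data.Sum.Function.Propositional using (_⊎-⇔_)
open import Data.Unit using (⊤; tt)
open import Data.Empty using (⊥-elim)
open import Function using (id; _∘_; const)
open import Function.Bundles using (_⇔_; mk⇔; module Equivalence)
open import Function.Construct.Composition using (_⇔-∘_)
open import Function.Construct.Identity using (⇔-id)
open import Function.Construct.Symmetry using (⇔-sym)
open import Function.Related.TypeIsomorphisms using (¬-cong-⇔)
open import Relation.Binary.PropositionalEquality
open import Relation.Nullary using (Dec; does; yes; no; ¬_)
open import Relation.Nullary.Decidable using (dec-true; dec-false)

-- Factors of partial words

module _ {A : Set} where

  infixr 5 _∷?_
  _∷?_ : Maybe A → List A → List A
  _∷?_ = maybe′ _∷_ id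

  ∷?-++ : ∀ x (u v : List A) → (x ∷? u) ++ v ≡ x ∷? (u ++ v)
  ∷?-++ (just _) u v = refl
  ∷?-++ nothing  u v = refl

  factorFrom : (ℕ → Maybe A) → ℕ → ℕ → List A
  factorFrom g a zero    = []
  factorFrom g a (suc l) = g a ∷? factorFrom g (suc a) l

  factor : (ℕ → Maybe A) → ℕ → ℕ → List A
  factor g a b = factorFrom g a (b ∸ a)

  module _ (g : ℕ → Maybe A) where

    factorFrom-++ : ∀ a l m → factorFrom g a (l + m) ≡ factorFrom g a l ++ factorFrom g (a + l) m
    factorFrom-++ a zero    m = cong (λ b → factorFrom g b m) (sym (+-identityʳ a))
    factorFrom-++ a (suc l) m = begin
      g a ∷? factorFrom g (suc a) (l + m)
        ≡⟨ cong (g a ∷?_) (factorFrom-++ (suc a) l m) ⟩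
      g a ∷? (factorFrom g (suc a) l ++ factorFrom g (suc (a + l)) m)
        ≡⟨ cong (λ b → g a ∷? (factorFrom g (suc a) l ++ factorFrom g b m)) (sym (+-suc a l)) ⟩
      g a ∷? (factorFrom g (suc a) l ++ factorFrom g (a + suc l) m)
        ≡⟨ sym (∷?-++ (g a) _ _) ⟩
      (g a ∷? factorFrom g (suc a) l) ++ factorFrom g (a + suc l) m ∎
      where open ≡-Reasoning

    factor-++ : ∀ {a i b} → a ≤ i → i ≤ b → factor g a b ≡ factor g a i ++ factor g i b
    factor-++ {a} {i} {b} a≤i i≤b = begin
      factorFrom g a (b ∸ a)
        ≡⟨ cong (factorFrom g a) b∸a≡ ⟩
      factorFrom g a ((i ∸ a) + (b ∸ i))
        ≡⟨ factorFrom-++ a (i ∸ a) (b ∸ i) ⟩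
      factor g a i ++ factorFrom g (a + (i ∸ a)) (b ∸ i)
        ≡⟨ cong (λ c → factor g a i ++ factorFrom g c (b ∸ i)) (m+[n∸m]≡n a≤i) ⟩
      factor g a i ++ factor g i b ∎
      where
      open ≡-Reasoning
      b∸a≡ : b ∸ a ≡ (i ∸ a) + (b ∸ i)
      b∸a≡ = trans (cong (_∸ a) (sym (m+[n∸m]≡n i≤b))) (+-∸-comm (b ∸ i) a≤i)

    factor-singleton : ∀ p → factor g p (suc p) ≡ g p ∷? []
    factor-singleton p = cong (factorFrom g p) (m+n∸n≡m 1 p)

    factor-at : ∀ {a p b} → a ≤ p → p < b → factor g a b ≡ factor g a p ++ g p ∷? factor g (suc p) b
    factor-at {a} {p} {b} a≤p p<b = begin
      factor g a b                                          ≡⟨ factor-++ a≤p (<⇒≤ p<b) ⟩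
      factor g a p ++ factor g p b                          ≡⟨ cong (factor g a p ++_) (factor-++ (n≤1+n p) p<b) ⟩
      factor g a p ++ (factor g p (suc p) ++ factor g (suc p) b)
        ≡⟨ cong (λ u → factor g a p ++ (u ++ factor g (suc p) b)) (factor-singleton p) ⟩
      factor g a p ++ ((g p ∷? []) ++ factor g (suc p) b)   ≡⟨ cong (factor g a p ++_) (∷?-++ (g p) [] _) ⟩
      factor g a p ++ g p ∷? factor g (suc p) b ∎
      where open ≡-Reasoning

  factorFrom-cong : ∀ {g h : ℕ → Maybe A} a l → (∀ p → a ≤ p → p < a + l → g p ≡ h p) →
                    factorFrom g a l ≡ factorFrom h a l
  factorFrom-cong a zero    g≗h = refl
  factorFrom-cong a (suc l) g≗h =
    cong₂ _∷?_ (g≗h a ≤-refl a<a+1+l)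
               (factorFrom-cong (suc a) l (λ p a<p p< → g≗h p (<⇒≤ a<p) (subst (p <_) (sym (+-suc a l)) p<)))
    where a<a+1+l = subst (a <_) (sym (+-suc a l)) (s≤s (m≤m+n a l))

  factor-cong : ∀ {g h : ℕ → Maybe A} {a b} → a ≤ b → (∀ p → a ≤ p → p < b → g p ≡ h p) →
                factor g a b ≡ factor h a b
  factor-cong {a = a} {b} a≤b g≗h =
    factorFrom-cong a (b ∸ a) (λ p a≤p p< → g≗h p a≤p (subst (p <_) (m+[n∸m]≡n a≤b) p<))

  factorFrom-blank : ∀ a l → factorFrom (const nothing) a l ≡ []
  factorFrom-blank a zero    = refl
  factorFrom-blank a (suc l) = factorFrom-blank (suc a) l

  factor-blank : ∀ {g : ℕ → Maybe A} {a b} → a ≤ b → (∀ p → a ≤ p → p < b → g p ≡ nothing) →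
                 factor g a b ≡ []
  factor-blank {a = a} {b} a≤b blank = trans (factor-cong a≤b blank) (factorFrom-blank a (b ∸ a))

  module _ (g : ℕ → Maybe A) where

    SplitFrom : ℕ → ℕ → List A → List A → Set
    SplitFrom c l u v = Σ ℕ λ m → m ≤ l × factorFrom g c m ≡ u × factorFrom g (c + m) (l ∸ m) ≡ v

    splitFrom-step : ∀ {c l u u′ v} → (∀ {m} → factorFrom g (suc c) m ≡ u′ → factorFrom g c (suc m) ≡ u) →
                     SplitFrom (suc c) l u′ v → SplitFrom c (suc l) u v
    splitFrom-step {c} {l} extend (m , m≤l , e₁ , e₂) =
      suc m , s≤s m≤l , extend {m} e₁ , trans (cong (λ b → factorFrom g b (l ∸ m)) (+-suc c m)) e₂

    factorFrom-split : ∀ c l (u v : List A) → factorFrom g c l ≡ u ++ v → SplitFrom c l u v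
    factorFrom-split c l [] v e = 0 , z≤n , refl , trans (cong (λ b → factorFrom g b l) (+-identityʳ c)) e
    factorFrom-split c (suc l) (x ∷ u) v e with g c in gc
    ... | nothing = splitFrom-step (λ {m} → trans (cong (_∷? factorFrom g (suc c) m) gc))
                                   (factorFrom-split (suc c) l (x ∷ u) v e)
    ... | just y with refl , e′ ← ∷-injective e =
      splitFrom-step (λ {m} e₁ → trans (cong (_∷? factorFrom g (suc c) m) gc) (cong (y ∷_) e₁))
                     (factorFrom-split (suc c) l u v e′)

    SplitFromAt : ℕ → ℕ → List A → A → List A → Set
    SplitFromAt c l u ζ v = Σ ℕ λ m → m < l × g (c + m) ≡ just ζ ×
                              factorFrom g c m ≡ u × factorFrom g (suc (c + m)) (l ∸ suc m) ≡ v

    splitFromAt-step : ∀ {c l u u′ ζ v} → (∀ {m} → factorFrom g (suc c) m ≡ u′ → factorFrom g c (suc m) ≡ u) →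
                       SplitFromAt (suc c) l u′ ζ v → SplitFromAt c (suc l) u ζ v
    splitFromAt-step {c} {l} extend (m , m<l , gζ , e₁ , e₂) =
      suc m , s≤s m<l , trans (cong g (+-suc c m)) gζ , extend {m} e₁ ,
      trans (cong (λ b → factorFrom g (suc b) (l ∸ suc m)) (+-suc c m)) e₂

    factorFrom-split-at : ∀ c l (u : List A) ζ v → factorFrom g c l ≡ u ++ ζ ∷ v → SplitFromAt c l u ζ v
    factorFrom-split-at c zero [] ζ v ()
    factorFrom-split-at c zero (_ ∷ _) ζ v ()
    factorFrom-split-at c (suc l) u ζ v e with g c in gc
    ... | nothing = splitFromAt-step (λ {m} → trans (cong (_∷? factorFrom g (suc c) m) gc))
                                     (factorFrom-split-at (suc c) l u ζ v e)
    factorFrom-split-at c (suc l) [] ζ v e | just y with refl , e′ ← ∷-injective e =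
      0 , s≤s z≤n , trans (cong g (+-identityʳ c)) gc , refl ,
      trans (cong (λ b → factorFrom g (suc b) l) (+-identityʳ c)) e′
    factorFrom-split-at c (suc l) (x ∷ u) ζ v e | just y with refl , e′ ← ∷-injective e =
      splitFromAt-step (λ {m} e₁ → trans (cong (_∷? factorFrom g (suc c) m) gc) (cong (y ∷_) e₁))
                       (factorFrom-split-at (suc c) l u ζ v e′)

    factor-split : ∀ {c d} (u v : List A) → c ≤ d → factor g c d ≡ u ++ v →
      Σ ℕ λ j → c ≤ j × j ≤ d × factor g c j ≡ u × factor g j d ≡ v
    factor-split {c} {d} u v c≤d e with m , m≤ , e₁ , e₂ ← factorFrom-split c (d ∸ c) u v e =
      c + m , m≤m+n c m , subst (c + m ≤_) (m+[n∸m]≡n c≤d) (+-monoʳ-≤ c m≤) ,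
      trans (cong (factorFrom g c) (m+n∸m≡n c m)) e₁ ,
      trans (cong (factorFrom g (c + m)) (sym (∸-+-assoc d c m))) e₂

    factor-split-at : ∀ {c d} (u : List A) ζ v → c ≤ d → factor g c d ≡ u ++ ζ ∷ v →
      Σ ℕ λ j → c ≤ j × j < d × g j ≡ just ζ × factor g c j ≡ u × factor g (suc j) d ≡ v
    factor-split-at {c} {d} u ζ v c≤d e with m , m< , gζ , e₁ , e₂ ← factorFrom-split-at c (d ∸ c) u ζ v e =
      c + m , m≤m+n c m , subst (c + m <_) (m+[n∸m]≡n c≤d) (+-monoʳ-< c m<) , gζ ,
      trans (cong (factorFrom g c) (m+n∸m≡n c m)) e₁ ,
      trans (cong (factorFrom g (suc (c + m))) (trans (cong (d ∸_) (sym (+-suc c m))) (sym (∸-+-assoc d c (suc m))))) e₂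

    ++-∷≡factor⇔ : ∀ {c d} (u : List A) ζ v → c ≤ d → (u ++ ζ ∷ v ≡ factor g c d) ⇔
      (Σ ℕ λ j → c ≤ j × j < d × g j ≡ just ζ × u ≡ factor g c j × v ≡ factor g (suc j) d)
    ++-∷≡factor⇔ {c} {d} u ζ v c≤d = mk⇔
      (λ e → let j , c≤j , j<d , gj , e₁ , e₂ = factor-split-at u ζ v c≤d (sym e) in
             j , c≤j , j<d , gj , sym e₁ , sym e₂)
      (λ (j , c≤j , j<d , gj , e₁ , e₂) → begin
         u ++ ζ ∷ v                                 ≡⟨ cong₂ (λ u′ v′ → u′ ++ ζ ∷ v′) e₁ e₂ ⟩
         factor g c j ++ ζ ∷ factor g (suc j) d     ≡⟨ cong (λ y → factor g c j ++ y ∷? factor g (suc j) d) (sym gj) ⟩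
         factor g c j ++ g j ∷? factor g (suc j) d  ≡⟨ sym (factor-at g c≤j j<d) ⟩
         factor g c d ∎)
      where open ≡-Reasoning

    ++≡factor⇔ : ∀ {c d} (u v : List A) → c ≤ d → (u ++ v ≡ factor g c d) ⇔
      (Σ ℕ λ j → c ≤ j × j ≤ d × u ≡ factor g c j × v ≡ factor g j d)
    ++≡factor⇔ u v c≤d = mk⇔
      (λ e → let j , c≤j , j≤d , e₁ , e₂ = factor-split u v c≤d (sym e) in j , c≤j , j≤d , sym e₁ , sym e₂)
      (λ (j , c≤j , j≤d , e₁ , e₂) → trans (cong₂ _++_ e₁ e₂) (sym (factor-++ g c≤j j≤d)))

  window : ℕ → ℕ → (ℕ → Maybe A) → ℕ → Maybe A
  window a b g p = if does (a ℕ.≤? p) && does (p ℕ.≤? b) then g p else nothing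

  factor-window : ∀ (g : ℕ → Maybe A) {a b L} → a ≤ b → b < L → factor (window a b g) 0 L ≡ factor g a (suc b)
  factor-window g {a} {b} {L} a≤b b<L = begin
    factor gᵂ 0 L                                              ≡⟨ factor-++ gᵂ z≤n (≤-trans a≤1+b b<L) ⟩
    factor gᵂ 0 a ++ factor gᵂ a L                             ≡⟨ cong (factor gᵂ 0 a ++_) (factor-++ gᵂ a≤1+b b<L) ⟩
    factor gᵂ 0 a ++ factor gᵂ a (suc b) ++ factor gᵂ (suc b) L
      ≡⟨ cong₂ (λ u v → u ++ v ++ factor gᵂ (suc b) L) (factor-blank z≤n left) (factor-cong a≤1+b inside) ⟩
    factor g a (suc b) ++ factor gᵂ (suc b) L                  ≡⟨ cong (factor g a (suc b) ++_) (factor-blank b<L right) ⟩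
    factor g a (suc b) ++ []                                   ≡⟨ ++-identityʳ _ ⟩
    factor g a (suc b) ∎
    where
    open ≡-Reasoning
    gᵂ = window a b g
    a≤1+b = m≤n⇒m≤1+n a≤b
    left : ∀ p → 0 ≤ p → p < a → gᵂ p ≡ nothing
    left p _ p<a rewrite dec-false (a ℕ.≤? p) (<⇒≱ p<a) = refl
    inside : ∀ p → a ≤ p → p < suc b → gᵂ p ≡ g p
    inside p a≤p p≤b rewrite dec-true (a ℕ.≤? p) a≤p | dec-true (p ℕ.≤? b) (≤-pred p≤b) = refl
    right : ∀ p → suc b ≤ p → p < L → gᵂ p ≡ nothing
    right p b<p _ rewrite dec-false (p ℕ.≤? b) (<⇒≱ b<p) with does (a ℕ.≤? p)
    ... | true  = refl
    ... | false = refl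

  catMaybes-tabulate : ∀ {m} (h : Fin m → Maybe A) {g : ℕ → Maybe A} {o} → (∀ p → h p ≡ g (o + toℕ p)) →
                       catMaybes (tabulate h) ≡ factorFrom g o m
  catMaybes-tabulate {zero}  h         h≗g = refl
  catMaybes-tabulate {suc m} h {g} {o} h≗g =
    cong₂ _∷?_ (trans (h≗g zero) (cong g (+-identityʳ o)))
               (catMaybes-tabulate (h ∘ suc) (λ p → trans (h≗g (suc p)) (cong g (+-suc o (toℕ p)))))

Apart : ℕ → ℕ → ℕ → Set
Apart i a b = i < a ⊎ b ≤ i

Ordered : ℕ → ℕ → ℕ → ℕ → Set
Ordered a b c d = a ≤ b × b ≤ c × c ≤ d

apart-≢ : ∀ {i a b p} → Apart i a b → a ≤ p → p < b → p ≢ i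
apart-≢ (inj₁ i<a) a≤p _   refl = <⇒≱ i<a a≤p
apart-≢ (inj₂ b≤i) _   p<b refl = <⇒≱ p<b b≤i

module _ {A : Set} where

  EqualFactors : (ℕ → Maybe A) → ℕ → ℕ → ℕ → ℕ → Set
  EqualFactors g a b c d = Ordered a b c d × factor g a b ≡ factor g c d

  record UpdatedAt (g g′ : ℕ → Maybe A) (i : ℕ) (x : Maybe A) : Set where
    field
      updated   : g′ i ≡ x
      unchanged : ∀ p → p ≢ i → g′ p ≡ g p

  module _ {g g′ : ℕ → Maybe A} {i : ℕ} {x : Maybe A} (U : UpdatedAt g g′ i x) where
    open UpdatedAt U
    open Equivalence using (to; from)

    factor-apart : ∀ {a b} → a ≤ b → Apart i a b → factor g′ a b ≡ factor g a b
    factor-apart a≤b i∉ab = factor-cong a≤b (λ p a≤p p<b → unchanged p (apart-≢ i∉ab a≤p p<b))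

    factor-through : ∀ {a b} → a ≤ i → i < b → factor g′ a b ≡ factor g a i ++ x ∷? factor g (suc i) b
    factor-through a≤i i<b = trans (factor-at g′ a≤i i<b)
      (cong₂ _++_ (factor-apart a≤i (inj₂ ≤-refl)) (cong₂ _∷?_ updated (factor-apart i<b (inj₁ (n<1+n i)))))

    equalFactors-apart : ∀ {a b c d} → Apart i a b → Apart i c d →
                         EqualFactors g′ a b c d ⇔ EqualFactors g a b c d
    equalFactors-apart i∉ab i∉cd = mk⇔
      (λ (ord@(a≤b , _ , c≤d) , e) → ord , trans (sym (factor-apart a≤b i∉ab)) (trans e (factor-apart c≤d i∉cd)))
      (λ (ord@(a≤b , _ , c≤d) , e) → ord , trans (factor-apart a≤b i∉ab) (trans e (sym (factor-apart c≤d i∉cd))))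

    equalFactors-insertˡ : ∀ {ζ a b c d} → x ≡ just ζ → a ≤ i → i < b →
      EqualFactors g′ a b c d ⇔
      (Ordered a b c d × Σ ℕ λ j → c ≤ j × j < d × g′ j ≡ just ζ ×
                                   EqualFactors g a i c j × EqualFactors g (suc i) b (suc j) d)
    equalFactors-insertˡ {ζ} {a} {b} {c} {d} refl a≤i i<b = mk⇔
      (λ (ord@(_ , b≤c , c≤d) , e) →
        let j , c≤j , j<d , gj , e₁ , e₂ = to (++-∷≡factor⇔ g _ ζ _ c≤d)
              (trans (sym (factor-through a≤i i<b)) (trans e (factor-apart c≤d (inj₁ (i<c b≤c)))))
        in ord , j , c≤j , j<d , trans (unchanged j (j≢i b≤c c≤j)) gj ,
           ((a≤i , <⇒≤ (i<c b≤c) , c≤j) , e₁) , ((i<b , ≤-trans b≤c (m≤n⇒m≤1+n c≤j) , j<d) , e₂))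
      (λ (ord@(_ , b≤c , c≤d) , j , c≤j , j<d , g′j , (_ , e₁) , (_ , e₂)) → ord ,
        trans (factor-through a≤i i<b)
          (trans (from (++-∷≡factor⇔ g _ ζ _ c≤d) (j , c≤j , j<d , trans (sym (unchanged j (j≢i b≤c c≤j))) g′j , e₁ , e₂))
                 (sym (factor-apart c≤d (inj₁ (i<c b≤c))))))
      where
      i<c : b ≤ c → i < c
      i<c = <-≤-trans i<b
      j≢i : ∀ {j} → b ≤ c → c ≤ j → j ≢ i
      j≢i b≤c c≤j = >⇒≢ (<-≤-trans (i<c b≤c) c≤j)

    equalFactors-insertʳ : ∀ {ζ a b c d} → x ≡ just ζ → c ≤ i → i < d →
      EqualFactors g′ a b c d ⇔
      (Ordered a b c d × Σ ℕ λ j → a ≤ j × j < b × g′ j ≡ just ζ ×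
                                   EqualFactors g a j c i × EqualFactors g (suc j) b (suc i) d)
    equalFactors-insertʳ {ζ} {a} {b} {c} {d} refl c≤i i<d = mk⇔
      (λ (ord@(a≤b , b≤c , _) , e) →
        let j , a≤j , j<b , gj , e₁ , e₂ = to (++-∷≡factor⇔ g _ ζ _ a≤b)
              (trans (sym (factor-through c≤i i<d)) (trans (sym e) (factor-apart a≤b (inj₂ (b≤i b≤c)))))
        in ord , j , a≤j , j<b , trans (unchanged j (j≢i b≤c j<b)) gj ,
           ((a≤j , ≤-trans (<⇒≤ j<b) b≤c , c≤i) , sym e₁) , ((j<b , m≤n⇒m≤1+n (b≤i b≤c) , i<d) , sym e₂))
      (λ (ord@(a≤b , b≤c , _) , j , a≤j , j<b , g′j , (_ , e₁) , (_ , e₂)) → ord ,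
        trans (factor-apart a≤b (inj₂ (b≤i b≤c)))
          (trans (sym (from (++-∷≡factor⇔ g _ ζ _ a≤b) (j , a≤j , j<b , trans (sym (unchanged j (j≢i b≤c j<b))) g′j , sym e₁ , sym e₂)))
                 (sym (factor-through c≤i i<d))))
      where
      b≤i : b ≤ c → b ≤ i
      b≤i b≤c = ≤-trans b≤c c≤i
      j≢i : ∀ {j} → b ≤ c → j < b → j ≢ i
      j≢i b≤c j<b = <⇒≢ (<-≤-trans j<b (b≤i b≤c))

    equalFactors-resetˡ : ∀ {a b c d} → x ≡ nothing → a ≤ i → i < b →
      EqualFactors g′ a b c d ⇔
      (Ordered a b c d × Σ ℕ λ j → c ≤ j × j ≤ d × EqualFactors g a i c j × EqualFactors g (suc i) b j d)
    equalFactors-resetˡ {a} {b} {c} {d} refl a≤i i<b = mk⇔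
      (λ (ord@(_ , b≤c , c≤d) , e) →
        let j , c≤j , j≤d , e₁ , e₂ = to (++≡factor⇔ g _ _ c≤d)
              (trans (sym (factor-through a≤i i<b)) (trans e (factor-apart c≤d (inj₁ (i<c b≤c)))))
        in ord , j , c≤j , j≤d , ((a≤i , <⇒≤ (i<c b≤c) , c≤j) , e₁) , ((i<b , ≤-trans b≤c c≤j , j≤d) , e₂))
      (λ (ord@(_ , b≤c , c≤d) , j , c≤j , j≤d , (_ , e₁) , (_ , e₂)) → ord ,
        trans (factor-through a≤i i<b)
          (trans (from (++≡factor⇔ g _ _ c≤d) (j , c≤j , j≤d , e₁ , e₂)) (sym (factor-apart c≤d (inj₁ (i<c b≤c))))))
      where
      i<c : b ≤ c → i < c
      i<c = <-≤-trans i<b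

    equalFactors-resetʳ : ∀ {a b c d} → x ≡ nothing → c ≤ i → i < d →
      EqualFactors g′ a b c d ⇔
      (Ordered a b c d × Σ ℕ λ j → a ≤ j × j ≤ b × EqualFactors g a j c i × EqualFactors g j b (suc i) d)
    equalFactors-resetʳ {a} {b} {c} {d} refl c≤i i<d = mk⇔
      (λ (ord@(a≤b , b≤c , _) , e) →
        let j , a≤j , j≤b , e₁ , e₂ = to (++≡factor⇔ g _ _ a≤b)
              (trans (sym (factor-through c≤i i<d)) (trans (sym e) (factor-apart a≤b (inj₂ (b≤i b≤c)))))
        in ord , j , a≤j , j≤b , ((a≤j , ≤-trans j≤b b≤c , c≤i) , sym e₁) ,
           ((j≤b , m≤n⇒m≤1+n (b≤i b≤c) , i<d) , sym e₂))
      (λ (ord@(a≤b , b≤c , _) , j , a≤j , j≤b , (_ , e₁) , (_ , e₂)) → ord ,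
        trans (factor-apart a≤b (inj₂ (b≤i b≤c)))
          (trans (sym (from (++≡factor⇔ g _ _ a≤b) (j , a≤j , j≤b , sym e₁ , sym e₂))) (sym (factor-through c≤i i<d))))
      where
      b≤i : b ≤ c → b ≤ i
      b≤i b≤c = ≤-trans b≤c c≤i

module _ {k : ℕ} where

  letterAt : ∀ {n} → Word k n → ℕ → Maybe (Fin k)
  letterAt {zero}  w _       = nothing
  letterAt {suc n} w zero    = w zero
  letterAt {suc n} w (suc p) = letterAt (w ∘ suc) p

  at≡letterAt : ∀ {n} (w : Word k n) (d : D n) → at w d ≡ letterAt w (toℕ d)
  at≡letterAt {zero}  w d       = refl
  at≡letterAt {suc n} w zero    = refl
  at≡letterAt {suc n} w (suc d) = at≡letterAt (w ∘ suc) d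

  letterAt-≥ : ∀ {n} (w : Word k n) {p} → n ≤ p → letterAt w p ≡ nothing
  letterAt-≥ {zero}  w         _         = refl
  letterAt-≥ {suc n} w {suc p} (s≤s n≤p) = letterAt-≥ (w ∘ suc) n≤p

  letterAt-toℕ : ∀ {n} (w : Word k n) (j : Fin n) → letterAt w (toℕ j) ≡ w j
  letterAt-toℕ w zero    = refl
  letterAt-toℕ w (suc j) = letterAt-toℕ (w ∘ suc) j

  letterAt-cong : ∀ {n} {w w′ : Word k n} p → (∀ j → toℕ j ≡ p → w′ j ≡ w j) → letterAt w′ p ≡ letterAt w p
  letterAt-cong {zero}  p       w≗w′ = refl
  letterAt-cong {suc n} zero    w≗w′ = w≗w′ zero refl
  letterAt-cong {suc n} (suc p) w≗w′ = letterAt-cong p (λ j e → w≗w′ (suc j) (cong suc e))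

  letterAt-emptyWord : ∀ {n} p → letterAt (emptyWord {k} {n}) p ≡ nothing
  letterAt-emptyWord {zero}  p       = refl
  letterAt-emptyWord {suc n} zero    = refl
  letterAt-emptyWord {suc n} (suc p) = letterAt-emptyWord {n} p

  setW-updatedAt : ∀ {n} (w : Word k n) (i : Fin n) x →
                   UpdatedAt (letterAt w) (letterAt (setW w i x)) (toℕ (inject₁ i)) x
  setW-updatedAt w i x = record
    { updated   = begin
        letterAt (setW w i x) (toℕ (inject₁ i)) ≡⟨ cong (letterAt (setW w i x)) (Finₚ.toℕ-inject₁ i) ⟩
        letterAt (setW w i x) (toℕ i)           ≡⟨ letterAt-toℕ (setW w i x) i ⟩
        setW w i x i                            ≡⟨ cong (if_then x else w i) (dec-true (i Finₚ.≟ i) refl) ⟩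
        x ∎
    ; unchanged = λ p p≢i → letterAt-cong p (λ j j≡p → setW-≢ j (λ { refl → p≢i (trans (sym j≡p) (sym (Finₚ.toℕ-inject₁ i))) }))
    }
    where
    open ≡-Reasoning
    setW-≢ : ∀ j → j ≢ i → setW w i x j ≡ w j
    setW-≢ j j≢i = cong (if_then x else w j) (dec-false (j Finₚ.≟ i) j≢i)

  substr≡factor : ∀ {n} (w : Word k n) {i j : D n} → toℕ i ≤ toℕ j → substr w i j ≡ factor (letterAt w) (toℕ i) (suc (toℕ j))
  substr≡factor {n} w {i} {j} i≤j = begin
    catMaybes (Data.List.map h (tabulate id))  ≡⟨ cong catMaybes (map-tabulate id h) ⟩
    catMaybes (tabulate h)                     ≡⟨ catMaybes-tabulate h {window (toℕ i) (toℕ j) (letterAt w)} {0} (λ p → cong (cut p) (at≡letterAt w p)) ⟩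
    factor (window (toℕ i) (toℕ j) (letterAt w)) 0 (suc n) ≡⟨ factor-window (letterAt w) i≤j (Finₚ.toℕ<n j) ⟩
    factor (letterAt w) (toℕ i) (suc (toℕ j)) ∎
    where
    open ≡-Reasoning
    cut : D n → Maybe (Fin k) → Maybe (Fin k)
    cut p x = if does (i Finₚ.≤? p) && does (p Finₚ.≤? j) then x else nothing
    h : D n → Maybe (Fin k)
    h p = cut p (at w p)

substr-≡⇔ : ∀ {k n} (w : Word k n) {xo xc yo yc : D n} → toℕ xo ≤ toℕ xc → toℕ yo ≤ toℕ yc →
  (substr w xo xc ≡ substr w yo yc) ⇔
  (factor (letterAt w) (toℕ xo) (suc (toℕ xc)) ≡ factor (letterAt w) (toℕ yo) (suc (toℕ yc)))
substr-≡⇔ w xo≤xc yo≤yc = mk⇔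
  (λ e → trans (sym (substr≡factor w xo≤xc)) (trans e (substr≡factor w yo≤yc)))
  (λ e → trans (substr≡factor w xo≤xc) (trans e (sym (substr≡factor w yo≤yc))))


point : ∀ {n p} → p < suc n → Σ (D n) λ P → toℕ P ≡ p
point p<1+n = fromℕ< p<1+n , Finₚ.toℕ-fromℕ< p<1+n

module _ {k n : ℕ} where

  letter⇒<n : ∀ {w : Word k n} p → at w p ≢ nothing → toℕ p < n
  letter⇒<n {w} p lettered with toℕ p ℕ.<? n
  ... | yes p<n = p<n
  ... | no  p≮n = ⊥-elim (lettered (trans (at≡letterAt w p) (letterAt-≥ w (≮⇒≥ p≮n))))

-- Formulas read as propositions

module _ {X : Set} {P Q : X → Set} (P⇔Q : ∀ x → P x ⇔ Q x) where
  open Equivalence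

  Σ-⇔ : Σ X P ⇔ Σ X Q
  Σ-⇔ = mk⇔ (λ (x , p) → x , to (P⇔Q x) p) (λ (x , q) → x , from (P⇔Q x) q)

  Π-⇔ : (∀ x → P x) ⇔ (∀ x → Q x)
  Π-⇔ = mk⇔ (λ p x → to (P⇔Q x) (p x)) (λ q x → from (P⇔Q x) (q x))

T-does : ∀ {P : Set} (P? : Dec P) → T (does P?) ⇔ P
T-does (yes p)  = mk⇔ (const p) (const tt)
T-does (no ¬p) = mk⇔ (λ ()) ¬p

T-not : ∀ b → T (not b) ⇔ (¬ T b)
T-not true  = mk⇔ (λ ()) (λ ¬t → ¬t tt)
T-not false = mk⇔ (λ _ ()) (const tt)

T-isLetter : ∀ {k} (x : Maybe (Fin k)) ζ → T (isLetter x ζ) ⇔ (x ≡ just ζ)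
T-isLetter (just ζ′) ζ = mk⇔ (cong just ∘ Equivalence.to (T-does (ζ′ Finₚ.≟ ζ)))
                             (λ { refl → Equivalence.from (T-does (ζ′ Finₚ.≟ ζ′)) refl })
T-isLetter nothing   ζ = mk⇔ (λ ()) (λ ())

T-anyFin : ∀ {m} (f : Fin m → Bool) → T (anyFin f) ⇔ Σ (Fin m) (T ∘ f)
T-anyFin {zero}  f = mk⇔ (λ ()) (λ ())
T-anyFin {suc m} f = mk⇔
  (λ h → [ (zero ,_) , (λ h′ → let i , fi = to (T-anyFin (f ∘ suc)) h′ in suc i , fi) ]′ (to T-∨ h))
  (λ { (zero , fi) → from T-∨ (inj₁ fi) ; (suc i , fi) → from T-∨ (inj₂ (from (T-anyFin (f ∘ suc)) (i , fi))) })
  where open Equivalence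

T-allFin? : ∀ {m} (f : Fin m → Bool) → T (allFin? f) ⇔ (∀ i → T (f i))
T-allFin? {zero}  f = mk⇔ (λ _ ()) (const tt)
T-allFin? {suc m} f = mk⇔
  (λ h → let f0 , fs = to T-∧ h in λ { zero → f0 ; (suc i) → to (T-allFin? (f ∘ suc)) fs i })
  (λ h → from T-∧ (h zero , from (T-allFin? (f ∘ suc)) (h ∘ suc)))
  where open Equivalence

-- A is only passed on to evalT, which ignores it.
module Semantics {k n a : ℕ} {ar : Fin a → ℕ} (w : Word k n) (A : AuxState ar n)
                 (S : (r : Fin a) → (Fin (ar r) → D n) → Set) where

  HoldsAtom : ∀ {m} → (Fin m → D n) → Atom k ar m → Set
  HoldsAtom ν (lt s t)     = toℕ (evalT w A ν s) < toℕ (evalT w A ν t)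
  HoldsAtom ν (eq s t)     = evalT w A ν s ≡ evalT w A ν t
  HoldsAtom ν (letter ζ t) = at w (evalT w A ν t) ≡ just ζ
  HoldsAtom ν (rel r ts)   = S r (λ i → evalT w A ν (ts i))

  Holds : ∀ {m} → (Fin m → D n) → CQ k ar m → Set
  Holds ν (atom α)  = HoldsAtom ν α
  Holds ν tt        = ⊤
  Holds ν (and φ ψ) = Holds ν φ × Holds ν ψ
  Holds ν (ex φ)    = Σ (D n) λ d → Holds (cons d ν) φ

  HoldsFO : ∀ {m} → (Fin m → D n) → FO k ar m → Set
  HoldsFO ν (atom α)  = HoldsAtom ν α
  HoldsFO ν tt        = ⊤
  HoldsFO ν (neg φ)   = ¬ HoldsFO ν φ
  HoldsFO ν (and φ ψ) = HoldsFO ν φ × HoldsFO ν ψ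
  HoldsFO ν (or φ ψ)  = HoldsFO ν φ ⊎ HoldsFO ν ψ
  HoldsFO ν (ex φ)    = Σ (D n) λ d → HoldsFO (cons d ν) φ
  HoldsFO ν (all φ)   = ∀ d → HoldsFO (cons d ν) φ

  module _ (A⇔S : ∀ r t → T (A r t) ⇔ S r t) where

    T-evalA : ∀ {m} (ν : Fin m → D n) α → T (evalA w A ν α) ⇔ HoldsAtom ν α
    T-evalA ν (lt s t)     = T-does (evalT w A ν s Finₚ.<? evalT w A ν t)
    T-evalA ν (eq s t)     = T-does (evalT w A ν s Finₚ.≟ evalT w A ν t)
    T-evalA ν (letter ζ t) = T-isLetter (at w (evalT w A ν t)) ζ
    T-evalA ν (rel r ts)   = A⇔S r _

    T-evalCQ : ∀ {m} (ν : Fin m → D n) φ → T (evalCQ w A ν φ) ⇔ Holds ν φ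
    T-evalCQ ν (atom α)  = T-evalA ν α
    T-evalCQ ν tt        = ⇔-id ⊤
    T-evalCQ ν (and φ ψ) = (T-evalCQ ν φ ×-⇔ T-evalCQ ν ψ) ⇔-∘ T-∧
    T-evalCQ ν (ex φ)    = Σ-⇔ (λ d → T-evalCQ (cons d ν) φ) ⇔-∘ T-anyFin _

    T-evalFO : ∀ {m} (ν : Fin m → D n) φ → T (evalFO w A ν φ) ⇔ HoldsFO ν φ
    T-evalFO ν (atom α)  = T-evalA ν α
    T-evalFO ν tt        = ⇔-id ⊤
    T-evalFO ν (neg φ)   = ¬-cong-⇔ (T-evalFO ν φ) ⇔-∘ T-not _
    T-evalFO ν (and φ ψ) = (T-evalFO ν φ ×-⇔ T-evalFO ν ψ) ⇔-∘ T-∧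
    T-evalFO ν (or φ ψ)  = (T-evalFO ν φ ⊎-⇔ T-evalFO ν ψ) ⇔-∘ T-∨
    T-evalFO ν (ex φ)    = Σ-⇔ (λ d → T-evalFO (cons d ν) φ) ⇔-∘ T-anyFin _
    T-evalFO ν (all φ)   = Π-⇔ (λ d → T-evalFO (cons d ν) φ) ⇔-∘ T-allFin? _

-- The program

$ : ∀ {n} → D n
$ = fromℕ _

Quad : ℕ → Set
Quad n = D n × D n × D n × D n

pattern factorsᴿ   = zero
pattern markedᴿ    = suc zero
pattern succᴿ      = suc (suc zero)
pattern distinctᴿ  = suc (suc (suc zero))
pattern insCaseᴿ   = suc (suc (suc (suc zero)))
pattern resetCaseᴿ = suc (suc (suc (suc (suc zero))))
pattern markCaseᴿ  = suc (suc (suc (suc (suc (suc zero)))))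
pattern outputᴿ    = suc (suc (suc (suc (suc (suc (suc zero))))))

arity : Fin 8 → ℕ
arity factorsᴿ   = 4
arity markedᴿ    = 1
arity succᴿ      = 2
arity distinctᴿ  = 2
arity insCaseᴿ   = 16
arity resetCaseᴿ = 15
arity markCaseᴿ  = 3
arity outputᴿ    = 4

module _ {n : ℕ} where

  -- How F(a, b, c, d) after ins at i is read off two F-atoms F₁, F₂ of the old word;
  -- j is the position matching i, and i′ = i + 1, j′ = j + 1.
  data InsCase (i i′ j j′ a b c d : D n) (F₁ F₂ : Quad n) : Set where
    apart : j ≡ i → Apart (toℕ i) (toℕ a) (toℕ b) → Apart (toℕ i) (toℕ c) (toℕ d) →
            F₁ ≡ (a , b , c , d) → F₂ ≡ ($ , $ , $ , $) → InsCase i i′ j j′ a b c d F₁ F₂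
    left  : Ordered (toℕ a) (toℕ b) (toℕ c) (toℕ d) →
            toℕ a ≤ toℕ i → toℕ i < toℕ b → toℕ c ≤ toℕ j → toℕ j < toℕ d →
            F₁ ≡ (a , i , c , j) → F₂ ≡ (i′ , b , j′ , d) → InsCase i i′ j j′ a b c d F₁ F₂
    right : Ordered (toℕ a) (toℕ b) (toℕ c) (toℕ d) →
            toℕ c ≤ toℕ i → toℕ i < toℕ d → toℕ a ≤ toℕ j → toℕ j < toℕ b →
            F₁ ≡ (a , j , c , i) → F₂ ≡ (j′ , b , i′ , d) → InsCase i i′ j j′ a b c d F₁ F₂

  data ResetCase (i i′ j a b c d : D n) (F₁ F₂ : Quad n) : Set where
    apart : Apart (toℕ i) (toℕ a) (toℕ b) → Apart (toℕ i) (toℕ c) (toℕ d) →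
            F₁ ≡ (a , b , c , d) → F₂ ≡ ($ , $ , $ , $) → ResetCase i i′ j a b c d F₁ F₂
    left  : Ordered (toℕ a) (toℕ b) (toℕ c) (toℕ d) →
            toℕ a ≤ toℕ i → toℕ i < toℕ b → toℕ c ≤ toℕ j → toℕ j ≤ toℕ d →
            F₁ ≡ (a , i , c , j) → F₂ ≡ (i′ , b , j , d) → ResetCase i i′ j a b c d F₁ F₂
    right : Ordered (toℕ a) (toℕ b) (toℕ c) (toℕ d) →
            toℕ c ≤ toℕ i → toℕ i < toℕ d → toℕ a ≤ toℕ j → toℕ j ≤ toℕ b →
            F₁ ≡ (a , j , c , i) → F₂ ≡ (j , b , i′ , d) → ResetCase i i′ j a b c d F₁ F₂

module _ {k : ℕ} where

  Marked : ∀ {n} → Word k n → D n → Set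
  Marked w x = x ≡ $ ⊎ at w x ≢ nothing

  Meaning : ∀ {n} → Word k n → (r : Fin 8) → (Fin (arity r) → D n) → Set
  Meaning w factorsᴿ   t = EqualFactors (letterAt w) (toℕ (t (# 0))) (toℕ (t (# 1))) (toℕ (t (# 2))) (toℕ (t (# 3)))
  Meaning w markedᴿ    t = Marked w (t (# 0))
  Meaning w succᴿ      t = toℕ (t (# 1)) ≡ suc (toℕ (t (# 0)))
  Meaning w distinctᴿ  t = t (# 0) ≢ t (# 1)
  Meaning w insCaseᴿ   t = InsCase (t (# 0)) (t (# 1)) (t (# 2)) (t (# 3)) (t (# 4)) (t (# 5)) (t (# 6)) (t (# 7))
                                   (t (# 8) , t (# 9) , t (# 10) , t (# 11)) (t (# 12) , t (# 13) , t (# 14) , t (# 15))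
  Meaning w resetCaseᴿ t = ResetCase (t (# 0)) (t (# 1)) (t (# 2)) (t (# 3)) (t (# 4)) (t (# 5)) (t (# 6))
                                     (t (# 7) , t (# 8) , t (# 9) , t (# 10)) (t (# 11) , t (# 12) , t (# 13) , t (# 14))
  Meaning w markCaseᴿ  t = t (# 2) ≡ t (# 1) ⊎ (t (# 1) ≡ t (# 0) × t (# 2) ≡ $)
  Meaning w outputᴿ    t = Req w t

  module _ {m : ℕ} where

    infixr 6 _∧ᶠ_
    infixr 5 _∨ᶠ_
    infix 7 _≐_ _≺_ _≼_ _≐₄_

    _∧ᶠ_ _∨ᶠ_ : FO k noAux m → FO k noAux m → FO k noAux m
    _∧ᶠ_ = and
    _∨ᶠ_ = or

    _≐_ _≺_ _≼_ : Term m → Term m → FO k noAux m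
    s ≐ t = atom (eq s t)
    s ≺ t = atom (lt s t)
    s ≼ t = s ≺ t ∨ᶠ s ≐ t

    apartᶠ : Term m → Term m → Term m → FO k noAux m
    apartᶠ i a b = i ≺ a ∨ᶠ b ≼ i

    orderedᶠ : Term m → Term m → Term m → Term m → FO k noAux m
    orderedᶠ a b c d = a ≼ b ∧ᶠ b ≼ c ∧ᶠ c ≼ d

    _≐₄_ : Term m × Term m × Term m × Term m → Term m × Term m × Term m × Term m → FO k noAux m
    (p , q , r , s) ≐₄ (a , b , c , d) = p ≐ a ∧ᶠ q ≐ b ∧ᶠ r ≐ c ∧ᶠ s ≐ d

  succᶠ : FO k noAux 2
  succᶠ = x ≺ y ∧ᶠ all (neg (var (# 1) ≺ var (# 0) ∧ᶠ var (# 0) ≺ var (# 2)))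
    where x = var (# 0) ; y = var (# 1)

  insCaseᶠ : FO k noAux 16
  insCaseᶠ =
       j ≐ i ∧ᶠ apartᶠ i a b ∧ᶠ apartᶠ i c d ∧ᶠ F₁ ≐₄ (a , b , c , d) ∧ᶠ F₂ ≐₄ (dollar , dollar , dollar , dollar)
    ∨ᶠ orderedᶠ a b c d ∧ᶠ a ≼ i ∧ᶠ i ≺ b ∧ᶠ c ≼ j ∧ᶠ j ≺ d ∧ᶠ F₁ ≐₄ (a , i , c , j) ∧ᶠ F₂ ≐₄ (i′ , b , j′ , d)
    ∨ᶠ orderedᶠ a b c d ∧ᶠ c ≼ i ∧ᶠ i ≺ d ∧ᶠ a ≼ j ∧ᶠ j ≺ b ∧ᶠ F₁ ≐₄ (a , j , c , i) ∧ᶠ F₂ ≐₄ (j′ , b , i′ , d)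
    where
    i = var (# 0) ; i′ = var (# 1) ; j = var (# 2) ; j′ = var (# 3)
    a = var (# 4) ; b = var (# 5) ; c = var (# 6) ; d = var (# 7)
    F₁ = var (# 8) , var (# 9) , var (# 10) , var (# 11)
    F₂ = var (# 12) , var (# 13) , var (# 14) , var (# 15)

  resetCaseᶠ : FO k noAux 15
  resetCaseᶠ =
       apartᶠ i a b ∧ᶠ apartᶠ i c d ∧ᶠ F₁ ≐₄ (a , b , c , d) ∧ᶠ F₂ ≐₄ (dollar , dollar , dollar , dollar)
    ∨ᶠ orderedᶠ a b c d ∧ᶠ a ≼ i ∧ᶠ i ≺ b ∧ᶠ c ≼ j ∧ᶠ j ≼ d ∧ᶠ F₁ ≐₄ (a , i , c , j) ∧ᶠ F₂ ≐₄ (i′ , b , j , d)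
    ∨ᶠ orderedᶠ a b c d ∧ᶠ c ≼ i ∧ᶠ i ≺ d ∧ᶠ a ≼ j ∧ᶠ j ≼ b ∧ᶠ F₁ ≐₄ (a , j , c , i) ∧ᶠ F₂ ≐₄ (j , b , i′ , d)
    where
    i = var (# 0) ; i′ = var (# 1) ; j = var (# 2)
    a = var (# 3) ; b = var (# 4) ; c = var (# 5) ; d = var (# 6)
    F₁ = var (# 7) , var (# 8) , var (# 9) , var (# 10)
    F₂ = var (# 11) , var (# 12) , var (# 13) , var (# 14)

  initFormula : (r : Fin 8) → FO k noAux (arity r)
  initFormula factorsᴿ   = orderedᶠ (var (# 0)) (var (# 1)) (var (# 2)) (var (# 3))
  initFormula markedᴿ    = var (# 0) ≐ dollar
  initFormula succᴿ      = succᶠ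
  initFormula distinctᴿ  = neg (var (# 0) ≐ var (# 1))
  initFormula insCaseᴿ   = insCaseᶠ
  initFormula resetCaseᴿ = resetCaseᶠ
  initFormula markCaseᴿ  = var (# 2) ≐ var (# 1) ∨ᶠ var (# 1) ≐ var (# 0) ∧ᶠ var (# 2) ≐ dollar
  initFormula outputᴿ    = neg tt

module _ {k : ℕ} where

  module _ {m : ℕ} where

    infixr 6 _∧ᶜ_

    _∧ᶜ_ : CQ k arity m → CQ k arity m → CQ k arity m
    _∧ᶜ_ = and

    R⟨_⟩ : (r : Fin 8) → Vec (Term m) (arity r) → CQ k arity m
    R⟨ r ⟩ ts = atom (rel r (lookup ts))

  ∃ⁿ : ∀ {m} l → CQ k arity (l + m) → CQ k arity m
  ∃ⁿ zero    φ = φ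
  ∃ⁿ (suc l) φ = ∃ⁿ l (ex φ)

  module _ {m : ℕ} where

    insFactors : Fin k → (y a b c d : Fin m) → CQ k arity m
    insFactors ζ y a b c d = ∃ⁿ 11
      (atom (letter ζ j) ∧ᶜ R⟨ succᴿ ⟩ (i ∷ i′ ∷ []) ∧ᶜ R⟨ succᴿ ⟩ (j ∷ j′ ∷ [])
       ∧ᶜ R⟨ insCaseᴿ ⟩ (i ∷ i′ ∷ j ∷ j′ ∷ ↑ a ∷ ↑ b ∷ ↑ c ∷ ↑ d ∷ p ∷ q ∷ r ∷ s ∷ t ∷ u ∷ v ∷ z ∷ [])
       ∧ᶜ R⟨ factorsᴿ ⟩ (p ∷ q ∷ r ∷ s ∷ []) ∧ᶜ R⟨ factorsᴿ ⟩ (t ∷ u ∷ v ∷ z ∷ []))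
      where
      ↑ : Fin m → Term (11 + m)
      ↑ x = var (11 ↑ʳ x)
      i = ↑ y
      j = var (# 10) ; i′ = var (# 9) ; j′ = var (# 8)
      p = var (# 7) ; q = var (# 6) ; r = var (# 5) ; s = var (# 4)
      t = var (# 3) ; u = var (# 2) ; v = var (# 1) ; z = var (# 0)

    resetFactors : (y a b c d : Fin m) → CQ k arity m
    resetFactors y a b c d = ∃ⁿ 10
      (R⟨ succᴿ ⟩ (i ∷ i′ ∷ [])
       ∧ᶜ R⟨ resetCaseᴿ ⟩ (i ∷ i′ ∷ j ∷ ↑ a ∷ ↑ b ∷ ↑ c ∷ ↑ d ∷ p ∷ q ∷ r ∷ s ∷ t ∷ u ∷ v ∷ z ∷ [])
       ∧ᶜ R⟨ factorsᴿ ⟩ (p ∷ q ∷ r ∷ s ∷ []) ∧ᶜ R⟨ factorsᴿ ⟩ (t ∷ u ∷ v ∷ z ∷ []))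
      where
      ↑ : Fin m → Term (10 + m)
      ↑ x = var (10 ↑ʳ x)
      i = ↑ y
      j = var (# 9) ; i′ = var (# 8)
      p = var (# 7) ; q = var (# 6) ; r = var (# 5) ; s = var (# 4)
      t = var (# 3) ; u = var (# 2) ; v = var (# 1) ; z = var (# 0)

    insMarked : (y x : Fin m) → CQ k arity m
    insMarked y x = ex (R⟨ markCaseᴿ ⟩ (var (suc y) ∷ var (suc x) ∷ var zero ∷ []) ∧ᶜ R⟨ markedᴿ ⟩ (var zero ∷ []))

    resetMarked : (y x : Fin m) → CQ k arity m
    resetMarked y x = R⟨ distinctᴿ ⟩ (var y ∷ var x ∷ []) ∧ᶜ R⟨ markedᴿ ⟩ (var x ∷ [])

    factorsUpdate : Op k → (y a b c d : Fin m) → CQ k arity m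
    factorsUpdate (ins ζ) = insFactors ζ
    factorsUpdate reset   = resetFactors

    markedUpdate : Op k → (y x : Fin m) → CQ k arity m
    markedUpdate (ins ζ) = insMarked
    markedUpdate reset   = resetMarked

  -- Update formulas only see the old auxiliary relations, so the new F and marks are inlined.
  outputUpdate : Op k → CQ k arity 5
  outputUpdate op = ∃ⁿ 2
    (R⟨ succᴿ ⟩ (var xc ∷ var b′ ∷ []) ∧ᶜ R⟨ succᴿ ⟩ (var yc ∷ var d′ ∷ [])
     ∧ᶜ atom (lt (var xo) (var b′)) ∧ᶜ atom (lt (var yo) (var d′)) ∧ᶜ atom (lt (var xc) (var yo))
     ∧ᶜ atom (lt (var yc) dollar)
     ∧ᶜ factorsUpdate op y xo b′ yo d′
     ∧ᶜ markedUpdate op y xo ∧ᶜ markedUpdate op y xc ∧ᶜ markedUpdate op y yo ∧ᶜ markedUpdate op y yc)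
    where
    d′ = # 0 ; b′ = # 1 ; y = # 2 ; xo = # 3 ; xc = # 4 ; yo = # 5 ; yc = # 6

  update : (r : Fin 8) → Op k → CQ k arity (suc (arity r))
  update factorsᴿ op = factorsUpdate op (# 0) (# 1) (# 2) (# 3) (# 4)
  update markedᴿ  op = markedUpdate op (# 0) (# 1)
  update outputᴿ  op = outputUpdate op
  update r        op = atom (rel r (var ∘ suc))

  program : DynCQProgram k
  program = record { a = 8 ; ar = arity ; init = initFormula ; upd = update ; out = outputᴿ ; out-ar = refl }

-- Correctness of the initialisation

module _ {n : ℕ} where
  open Equivalence

  <⊎≡⇔≤ : {x y : D n} → (toℕ x < toℕ y ⊎ x ≡ y) ⇔ toℕ x ≤ toℕ y
  <⊎≡⇔≤ = mk⇔ [ <⇒≤ , ≤-reflexive ∘ cong toℕ ]′ (map₂ Finₚ.toℕ-injective ∘ m≤n⇒m<n∨m≡n)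

  apart⇔ : {i a b : D n} → (toℕ i < toℕ a ⊎ (toℕ b < toℕ i ⊎ b ≡ i)) ⇔ Apart (toℕ i) (toℕ a) (toℕ b)
  apart⇔ = ⇔-id _ ⊎-⇔ <⊎≡⇔≤

  ordered⇔ : {a b c d : D n} → ((toℕ a < toℕ b ⊎ a ≡ b) × (toℕ b < toℕ c ⊎ b ≡ c) × (toℕ c < toℕ d ⊎ c ≡ d)) ⇔
                               Ordered (toℕ a) (toℕ b) (toℕ c) (toℕ d)
  ordered⇔ = <⊎≡⇔≤ ×-⇔ <⊎≡⇔≤ ×-⇔ <⊎≡⇔≤

  quad⇔ : {p q r s a b c d : D n} → (p ≡ a × q ≡ b × r ≡ c × s ≡ d) ⇔ ((p , q , r , s) ≡ (a , b , c , d))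
  quad⇔ = mk⇔ (λ { (refl , refl , refl , refl) → refl }) (λ { refl → refl , refl , refl , refl })

module _ {k n : ℕ} where
  open Semantics {k} {n} emptyWord noAuxState (λ ()) using (HoldsFO)
  open Equivalence

  ε : Word k n
  ε = emptyWord

  succᶠ⇔ : ∀ t → HoldsFO t succᶠ ⇔ (toℕ (t (# 1)) ≡ suc (toℕ (t (# 0))))
  succᶠ⇔ t = mk⇔ to′ from′
    where
    x = toℕ (t (# 0)) ; y = toℕ (t (# 1))
    to′ : HoldsFO t succᶠ → y ≡ suc x
    to′ (x<y , nothing-between) with m≤n⇒m<n∨m≡n x<y
    ... | inj₂ 1+x≡y = sym 1+x≡y
    ... | inj₁ 1+x<y = ⊥-elim (nothing-between (fromℕ< 1+x<1+n)
      (subst (x <_) (sym (Finₚ.toℕ-fromℕ< 1+x<1+n)) (n<1+n x) , subst (_< y) (sym (Finₚ.toℕ-fromℕ< 1+x<1+n)) 1+x<y))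
      where 1+x<1+n = <-≤-trans 1+x<y (Finₚ.toℕ≤n (t (# 1)))
    from′ : y ≡ suc x → HoldsFO t succᶠ
    from′ y≡1+x = subst (x <_) (sym y≡1+x) (n<1+n x) ,
                  λ d (x<d , d<y) → <⇒≱ x<d (≤-pred (subst (toℕ d <_) y≡1+x d<y))

  insCaseᶠ⇔ : ∀ t → HoldsFO t insCaseᶠ ⇔ Meaning ε insCaseᴿ t
  insCaseᶠ⇔ t = mk⇔
    (λ { (inj₁ (j≡i , i∉ab , i∉cd , F₁ , F₂)) →
           apart j≡i (to apart⇔ i∉ab) (to apart⇔ i∉cd) (to quad⇔ F₁) (to quad⇔ F₂)
       ; (inj₂ (inj₁ (ord , a≤i , i<b , c≤j , j<d , F₁ , F₂))) →
           left (to ordered⇔ ord) (to <⊎≡⇔≤ a≤i) i<b (to <⊎≡⇔≤ c≤j) j<d (to quad⇔ F₁) (to quad⇔ F₂)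
       ; (inj₂ (inj₂ (ord , c≤i , i<d , a≤j , j<b , F₁ , F₂))) →
           right (to ordered⇔ ord) (to <⊎≡⇔≤ c≤i) i<d (to <⊎≡⇔≤ a≤j) j<b (to quad⇔ F₁) (to quad⇔ F₂) })
    (λ { (apart j≡i i∉ab i∉cd F₁ F₂) →
           inj₁ (j≡i , from apart⇔ i∉ab , from apart⇔ i∉cd , from quad⇔ F₁ , from quad⇔ F₂)
       ; (left ord a≤i i<b c≤j j<d F₁ F₂) →
           inj₂ (inj₁ (from ordered⇔ ord , from <⊎≡⇔≤ a≤i , i<b , from <⊎≡⇔≤ c≤j , j<d , from quad⇔ F₁ , from quad⇔ F₂))
       ; (right ord c≤i i<d a≤j j<b F₁ F₂) →
           inj₂ (inj₂ (from ordered⇔ ord , from <⊎≡⇔≤ c≤i , i<d , from <⊎≡⇔≤ a≤j , j<b , from quad⇔ F₁ , from quad⇔ F₂)) })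

  resetCaseᶠ⇔ : ∀ t → HoldsFO t resetCaseᶠ ⇔ Meaning ε resetCaseᴿ t
  resetCaseᶠ⇔ t = mk⇔
    (λ { (inj₁ (i∉ab , i∉cd , F₁ , F₂)) →
           apart (to apart⇔ i∉ab) (to apart⇔ i∉cd) (to quad⇔ F₁) (to quad⇔ F₂)
       ; (inj₂ (inj₁ (ord , a≤i , i<b , c≤j , j≤d , F₁ , F₂))) →
           left (to ordered⇔ ord) (to <⊎≡⇔≤ a≤i) i<b (to <⊎≡⇔≤ c≤j) (to <⊎≡⇔≤ j≤d) (to quad⇔ F₁) (to quad⇔ F₂)
       ; (inj₂ (inj₂ (ord , c≤i , i<d , a≤j , j≤b , F₁ , F₂))) →
           right (to ordered⇔ ord) (to <⊎≡⇔≤ c≤i) i<d (to <⊎≡⇔≤ a≤j) (to <⊎≡⇔≤ j≤b) (to quad⇔ F₁) (to quad⇔ F₂) })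
    (λ { (apart i∉ab i∉cd F₁ F₂) →
           inj₁ (from apart⇔ i∉ab , from apart⇔ i∉cd , from quad⇔ F₁ , from quad⇔ F₂)
       ; (left ord a≤i i<b c≤j j≤d F₁ F₂) →
           inj₂ (inj₁ (from ordered⇔ ord , from <⊎≡⇔≤ a≤i , i<b , from <⊎≡⇔≤ c≤j , from <⊎≡⇔≤ j≤d ,
                       from quad⇔ F₁ , from quad⇔ F₂))
       ; (right ord c≤i i<d a≤j j≤b F₁ F₂) →
           inj₂ (inj₂ (from ordered⇔ ord , from <⊎≡⇔≤ c≤i , i<d , from <⊎≡⇔≤ a≤j , from <⊎≡⇔≤ j≤b ,
                       from quad⇔ F₁ , from quad⇔ F₂)) })

  at-emptyWord : ∀ x → at ε x ≡ nothing
  at-emptyWord x = trans (at≡letterAt ε x) (letterAt-emptyWord {k} {n} (toℕ x))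

  initFormula⇔ : ∀ r t → HoldsFO t (initFormula r) ⇔ Meaning ε r t
  initFormula⇔ factorsᴿ   t = mk⇔ (λ ord → let o = to ordered⇔ ord in o , trans (factor-ε (proj₁ o)) (sym (factor-ε (proj₂ (proj₂ o)))))
                                   (from ordered⇔ ∘ proj₁)
    where
    factor-ε : ∀ {a b} → a ≤ b → factor (letterAt ε) a b ≡ []
    factor-ε a≤b = factor-blank a≤b (λ p _ _ → letterAt-emptyWord {k} {n} p)
  initFormula⇔ markedᴿ    t = mk⇔ inj₁ [ id , (λ lettered → ⊥-elim (lettered (at-emptyWord (t (# 0))))) ]′
  initFormula⇔ succᴿ      t = succᶠ⇔ t
  initFormula⇔ distinctᴿ  t = ⇔-id _
  initFormula⇔ insCaseᴿ   t = insCaseᶠ⇔ t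
  initFormula⇔ resetCaseᴿ t = resetCaseᶠ⇔ t
  initFormula⇔ markCaseᴿ  t = ⇔-id _
  initFormula⇔ outputᴿ    t = mk⇔ (λ ¬⊤ → ⊥-elim (¬⊤ tt)) (λ (_ , _ , _ , _ , xo-letter , _) → ⊥-elim (xo-letter (at-emptyWord (t (# 0)))))

-- Correctness of the updates

module _ {k n : ℕ} where

  marked⇒letter : ∀ {w : Word k n} p → Marked w p → toℕ p < n → at w p ≢ nothing
  marked⇒letter p (inj₁ refl) p<n = λ _ → <-irrefl (Finₚ.toℕ-fromℕ n) p<n
  marked⇒letter p (inj₂ lettered) _   = lettered

module UpdateCorrectness {k n : ℕ} {w w′ : Word k n} (A : AuxState arity n) {x : Maybe (Fin k)}
                         {m : ℕ} (ν : Fin m → D n) (y : Fin m)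
                         (U : UpdatedAt (letterAt w) (letterAt w′) (toℕ (ν y)) x) (y<n : toℕ (ν y) < n) where
  open Semantics w′ A (Meaning w)
  open UpdatedAt U
  open Equivalence

  private
    g g′ : ℕ → Maybe (Fin k)
    g  = letterAt w
    g′ = letterAt w′

    locate : ∀ i a b → (a ≤ i × i < b) ⊎ Apart i a b
    locate i a b with a ℕ.≤? i | i ℕ.<? b
    ... | yes a≤i | yes i<b = inj₁ (a≤i , i<b)
    ... | no  a≰i | _       = inj₂ (inj₁ (≰⇒> a≰i))
    ... | yes _   | no  i≮b = inj₂ (inj₂ (≮⇒≥ i≮b))

    y+1 : Σ (D n) λ I′ → toℕ I′ ≡ suc (toℕ (ν y))
    y+1 = point (s≤s y<n)

    at′-updated : at w′ (ν y) ≡ x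
    at′-updated = trans (at≡letterAt w′ (ν y)) updated

    at′-unchanged : ∀ p → p ≢ ν y → at w′ p ≡ at w p
    at′-unchanged p p≢y = trans (at≡letterAt w′ p)
      (trans (unchanged (toℕ p) (p≢y ∘ Finₚ.toℕ-injective)) (sym (at≡letterAt w p)))

    equalFactors-$ : EqualFactors g (toℕ ($ {n})) (toℕ ($ {n})) (toℕ ($ {n})) (toℕ ($ {n}))
    equalFactors-$ = (≤-refl , ≤-refl , ≤-refl) , refl

  insFactors-correct : ∀ {ζ} → x ≡ just ζ → ∀ a b c d →
    Holds ν (insFactors ζ y a b c d) ⇔ EqualFactors g′ (toℕ (ν a)) (toℕ (ν b)) (toℕ (ν c)) (toℕ (ν d))
  insFactors-correct {ζ} x≡ζ a b c d = mk⇔ sound complete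
    where
    sound : Holds ν (insFactors ζ y a b c d) → EqualFactors g′ (toℕ (ν a)) (toℕ (ν b)) (toℕ (ν c)) (toℕ (ν d))
    sound (J , I′ , J′ , _ , _ , _ , _ , _ , _ , _ , _ , Jζ , I′≡ , J′≡ , case , F₁ , F₂) with case
    ... | apart refl y∉ab y∉cd refl refl = from (equalFactors-apart U y∉ab y∉cd) F₁
    ... | left ord a≤y y<b c≤J J<d refl refl =
      from (equalFactors-insertˡ U x≡ζ a≤y y<b)
        (ord , toℕ J , c≤J , J<d , trans (sym (at≡letterAt w′ J)) Jζ , F₁ ,
         subst₂ (λ p q → EqualFactors g p _ q _) I′≡ J′≡ F₂)
    ... | right ord c≤y y<d a≤J J<b refl refl =
      from (equalFactors-insertʳ U x≡ζ c≤y y<d)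
        (ord , toℕ J , a≤J , J<b , trans (sym (at≡letterAt w′ J)) Jζ , F₁ ,
         subst₂ (λ p q → EqualFactors g p _ q _) J′≡ I′≡ F₂)
    complete : EqualFactors g′ (toℕ (ν a)) (toℕ (ν b)) (toℕ (ν c)) (toℕ (ν d)) → Holds ν (insFactors ζ y a b c d)
    complete ef with y+1 | locate (toℕ (ν y)) (toℕ (ν a)) (toℕ (ν b))
    ... | I′ , I′≡ | inj₁ (a≤y , y<b)
      with ord , j , c≤j , j<d , g′j , F₁ , F₂ ← to (equalFactors-insertˡ U x≡ζ a≤y y<b) ef
      with J , refl ← point (<-trans j<d (Finₚ.toℕ<n (ν d)))
         | J′ , J′≡ ← point (s≤s (<-≤-trans j<d (≤-pred (Finₚ.toℕ<n (ν d))))) =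
      J , I′ , J′ , ν a , ν y , ν c , J , I′ , ν b , J′ , ν d ,
      trans (at≡letterAt w′ J) g′j , I′≡ , J′≡ , left ord a≤y y<b c≤j j<d refl refl ,
      F₁ , subst₂ (λ p q → EqualFactors g p _ q _) (sym I′≡) (sym J′≡) F₂
    ... | I′ , I′≡ | inj₂ y∉ab with locate (toℕ (ν y)) (toℕ (ν c)) (toℕ (ν d))
    ...   | inj₁ (c≤y , y<d)
      with ord , j , a≤j , j<b , g′j , F₁ , F₂ ← to (equalFactors-insertʳ U x≡ζ c≤y y<d) ef
      with J , refl ← point (<-trans j<b (Finₚ.toℕ<n (ν b)))
         | J′ , J′≡ ← point (s≤s (<-≤-trans j<b (≤-pred (Finₚ.toℕ<n (ν b))))) =
      J , I′ , J′ , ν a , J , ν c , ν y , J′ , ν b , I′ , ν d ,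
      trans (at≡letterAt w′ J) g′j , I′≡ , J′≡ , right ord c≤y y<d a≤j j<b refl refl ,
      F₁ , subst₂ (λ p q → EqualFactors g p _ q _) (sym J′≡) (sym I′≡) F₂
    ...   | inj₂ y∉cd =
      ν y , I′ , I′ , ν a , ν b , ν c , ν d , $ , $ , $ , $ ,
      trans at′-updated x≡ζ , I′≡ , I′≡ , apart refl y∉ab y∉cd refl refl ,
      to (equalFactors-apart U y∉ab y∉cd) ef , equalFactors-$

  resetFactors-correct : x ≡ nothing → ∀ a b c d →
    Holds ν (resetFactors y a b c d) ⇔ EqualFactors g′ (toℕ (ν a)) (toℕ (ν b)) (toℕ (ν c)) (toℕ (ν d))
  resetFactors-correct x≡ε a b c d = mk⇔ sound complete
    where
    sound : Holds ν (resetFactors y a b c d) → EqualFactors g′ (toℕ (ν a)) (toℕ (ν b)) (toℕ (ν c)) (toℕ (ν d))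
    sound (J , I′ , _ , _ , _ , _ , _ , _ , _ , _ , I′≡ , case , F₁ , F₂) with case
    ... | apart y∉ab y∉cd refl refl = from (equalFactors-apart U y∉ab y∉cd) F₁
    ... | left ord a≤y y<b c≤J J≤d refl refl =
      from (equalFactors-resetˡ U x≡ε a≤y y<b) (ord , toℕ J , c≤J , J≤d , F₁ , subst (λ p → EqualFactors g p _ _ _) I′≡ F₂)
    ... | right ord c≤y y<d a≤J J≤b refl refl =
      from (equalFactors-resetʳ U x≡ε c≤y y<d) (ord , toℕ J , a≤J , J≤b , F₁ , subst (λ q → EqualFactors g _ _ q _) I′≡ F₂)
    complete : EqualFactors g′ (toℕ (ν a)) (toℕ (ν b)) (toℕ (ν c)) (toℕ (ν d)) → Holds ν (resetFactors y a b c d)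
    complete ef with y+1 | locate (toℕ (ν y)) (toℕ (ν a)) (toℕ (ν b))
    ... | I′ , I′≡ | inj₁ (a≤y , y<b)
      with ord , j , c≤j , j≤d , F₁ , F₂ ← to (equalFactors-resetˡ U x≡ε a≤y y<b) ef
      with J , refl ← point (≤-<-trans j≤d (Finₚ.toℕ<n (ν d))) =
      J , I′ , ν a , ν y , ν c , J , I′ , ν b , J , ν d ,
      I′≡ , left ord a≤y y<b c≤j j≤d refl refl , F₁ , subst (λ p → EqualFactors g p _ _ _) (sym I′≡) F₂
    ... | I′ , I′≡ | inj₂ y∉ab with locate (toℕ (ν y)) (toℕ (ν c)) (toℕ (ν d))
    ...   | inj₁ (c≤y , y<d)
      with ord , j , a≤j , j≤b , F₁ , F₂ ← to (equalFactors-resetʳ U x≡ε c≤y y<d) ef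
      with J , refl ← point (≤-<-trans j≤b (Finₚ.toℕ<n (ν b))) =
      J , I′ , ν a , J , ν c , ν y , J , ν b , I′ , ν d ,
      I′≡ , right ord c≤y y<d a≤j j≤b refl refl , F₁ , subst (λ q → EqualFactors g _ _ q _) (sym I′≡) F₂
    ...   | inj₂ y∉cd =
      ν y , I′ , ν a , ν b , ν c , ν d , $ , $ , $ , $ ,
      I′≡ , apart y∉ab y∉cd refl refl , to (equalFactors-apart U y∉ab y∉cd) ef , equalFactors-$

  private
    marked-unchanged : ∀ p → p ≢ ν y → Marked w′ p ⇔ Marked w p
    marked-unchanged p p≢y = ⇔-id _ ⊎-⇔ mk⇔ (subst (_≢ nothing) (at′-unchanged p p≢y))
                                             (subst (_≢ nothing) (sym (at′-unchanged p p≢y)))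

  insMarked-correct : ∀ {ζ} → x ≡ just ζ → ∀ z → Holds ν (insMarked y z) ⇔ Marked w′ (ν z)
  insMarked-correct x≡ζ z = mk⇔ sound complete
    where
    y-lettered : at w′ (ν y) ≢ nothing
    y-lettered e with () ← trans (sym (trans at′-updated x≡ζ)) e
    sound : Holds ν (insMarked y z) → Marked w′ (ν z)
    sound (_ , inj₂ (z≡y , _) , _) = inj₂ (subst (λ p → at w′ p ≢ nothing) (sym z≡y) y-lettered)
    sound (_ , inj₁ refl , marked) with ν z Finₚ.≟ ν y
    ... | yes z≡y = inj₂ (subst (λ p → at w′ p ≢ nothing) (sym z≡y) y-lettered)
    ... | no  z≢y = from (marked-unchanged (ν z) z≢y) marked
    complete : Marked w′ (ν z) → Holds ν (insMarked y z)
    complete marked with ν z Finₚ.≟ ν y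
    ... | yes z≡y = $ , inj₂ (z≡y , refl) , inj₁ refl
    ... | no  z≢y = ν z , inj₁ refl , to (marked-unchanged (ν z) z≢y) marked

  resetMarked-correct : x ≡ nothing → ∀ z → Holds ν (resetMarked y z) ⇔ Marked w′ (ν z)
  resetMarked-correct x≡ε z = mk⇔
    (λ (y≢z , marked) → from (marked-unchanged (ν z) (≢-sym y≢z)) marked)
    (λ marked → y≢z marked , to (marked-unchanged (ν z) (≢-sym (y≢z marked))) marked)
    where
    y≢z : Marked w′ (ν z) → ν y ≢ ν z
    y≢z marked y≡z = marked⇒letter (ν y) (subst (Marked w′) (sym y≡z) marked) y<n (trans at′-updated x≡ε)

  factorsUpdate-correct : ∀ op → x ≡ newLetter op → ∀ a b c d →
    Holds ν (factorsUpdate op y a b c d) ⇔ EqualFactors g′ (toℕ (ν a)) (toℕ (ν b)) (toℕ (ν c)) (toℕ (ν d))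
  factorsUpdate-correct (ins ζ) = insFactors-correct
  factorsUpdate-correct reset   = resetFactors-correct

  markedUpdate-correct : ∀ op → x ≡ newLetter op → ∀ z → Holds ν (markedUpdate op y z) ⇔ Marked w′ (ν z)
  markedUpdate-correct (ins ζ) = insMarked-correct
  markedUpdate-correct reset   = resetMarked-correct

module OutputCorrectness {k n : ℕ} {w w′ : Word k n} (A : AuxState arity n) {i : D n} {x : Maybe (Fin k)}
                         (U : UpdatedAt (letterAt w) (letterAt w′) (toℕ i) x) (i<n : toℕ i < n)
                         (op : Op k) (x≡op : x ≡ newLetter op) (t : Fin 4 → D n) where
  open Semantics w′ A (Meaning w)
  open Equivalence

  private
    xo = t (# 0) ; xc = t (# 1) ; yo = t (# 2) ; yc = t (# 3)
    module Inner (B′ D′ : D n) = UpdateCorrectness A (cons D′ (cons B′ (cons i t))) (# 2) U i<n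

  outputUpdate-correct : Holds (cons i t) (outputUpdate op) ⇔ Req w′ t
  outputUpdate-correct = mk⇔ sound complete
    where
    sound : Holds (cons i t) (outputUpdate op) → Req w′ t
    sound (B′ , D′ , B′≡ , D′≡ , xo<B′ , yo<D′ , xc<yo , yc<$ , F , Mxo , Mxc , Myo , Myc) =
      xo≤xc , yo≤yc , from (substr-≡⇔ w′ xo≤xc yo≤yc) (subst₂ (λ b d → factor (letterAt w′) (toℕ xo) b ≡ factor (letterAt w′) (toℕ yo) d) B′≡ D′≡ factors≡) ,
      xc<yo , lettered (# 3) Mxo (≤-<-trans xo≤xc xc<n) , lettered (# 4) Mxc xc<n ,
              lettered (# 5) Myo (≤-<-trans yo≤yc yc<n) , lettered (# 6) Myc yc<n
      where
      open Inner B′ D′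
      factors≡ = proj₂ (to (factorsUpdate-correct op x≡op (# 3) (# 1) (# 5) (# 0)) F)
      xo≤xc = ≤-pred (subst (toℕ xo <_) B′≡ xo<B′)
      yo≤yc = ≤-pred (subst (toℕ yo <_) D′≡ yo<D′)
      yc<n = subst (toℕ yc <_) (Finₚ.toℕ-fromℕ n) yc<$
      xc<n = <-≤-trans xc<yo (≤-trans yo≤yc (<⇒≤ yc<n))
      ν′ = cons D′ (cons B′ (cons i t))
      lettered : ∀ z → Holds ν′ (markedUpdate op (# 2) z) → toℕ (ν′ z) < n → at w′ (ν′ z) ≢ nothing
      lettered z M = marked⇒letter (ν′ z) (to (markedUpdate-correct op x≡op z) M)
    build : Σ (D n) (λ B′ → toℕ B′ ≡ suc (toℕ xc)) → Σ (D n) (λ D′ → toℕ D′ ≡ suc (toℕ yc)) →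
            Req w′ t → Holds (cons i t) (outputUpdate op)
    build (B′ , B′≡) (D′ , D′≡) (xo≤xc , yo≤yc , substr≡ , xc<yo , lxo , lxc , lyo , lyc) =
      B′ , D′ , B′≡ , D′≡ , subst (toℕ xo <_) (sym B′≡) (s≤s xo≤xc) , subst (toℕ yo <_) (sym D′≡) (s≤s yo≤yc) ,
      xc<yo , subst (toℕ yc <_) (sym (Finₚ.toℕ-fromℕ n)) yc<n ,
      from (factorsUpdate-correct op x≡op (# 3) (# 1) (# 5) (# 0))
        ((subst (toℕ xo ≤_) (sym B′≡) (m≤n⇒m≤1+n xo≤xc) , subst (_≤ toℕ yo) (sym B′≡) xc<yo ,
          subst (toℕ yo ≤_) (sym D′≡) (m≤n⇒m≤1+n yo≤yc)) ,
         subst₂ (λ b d → factor (letterAt w′) (toℕ xo) b ≡ factor (letterAt w′) (toℕ yo) d) (sym B′≡) (sym D′≡) (to (substr-≡⇔ w′ xo≤xc yo≤yc) substr≡)) ,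
      mark (# 3) lxo , mark (# 4) lxc , mark (# 5) lyo , mark (# 6) lyc
      where
      open Inner B′ D′
      yc<n = letter⇒<n yc lyc
      ν′ = cons D′ (cons B′ (cons i t))
      mark : ∀ z → at w′ (ν′ z) ≢ nothing → Holds ν′ (markedUpdate op (# 2) z)
      mark z lz = from (markedUpdate-correct op x≡op z) (inj₂ lz)
    complete : Req w′ t → Holds (cons i t) (outputUpdate op)
    complete req@(_ , yo≤yc , _ , xc<yo , _ , _ , _ , lyc) = build (point (s≤s xc<n)) (point (s≤s yc<n)) req
      where
      yc<n = letter⇒<n yc lyc
      xc<n = <-≤-trans xc<yo (≤-trans yo≤yc (<⇒≤ yc<n))

module _ {k n : ℕ} where

  Invariant : Word k n → AuxState arity n → Set
  Invariant w A = ∀ r t → T (A r t) ⇔ Meaning w r t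

  initial-invariant : Invariant emptyWord (initAux (program {k}))
  initial-invariant r t = initFormula⇔ r t ⇔-∘ Semantics.T-evalFO emptyWord noAuxState (λ ()) (λ ()) t (initFormula r)

  step-invariant : ∀ {w A} → Invariant w A → (op : Op k) (i : Fin n) →
    Invariant (setW w i (newLetter op)) (λ r t → evalCQ (setW w i (newLetter op)) A (cons (inject₁ i) t) (update r op))
  step-invariant {w} {A} inv op i r t = update⇔ r t ⇔-∘ T-evalCQ inv (cons (inject₁ i) t) (update r op)
    where
    w′ = setW w i (newLetter op)
    open Semantics w′ A (Meaning w)
    U = setW-updatedAt w i (newLetter op)
    i<n = subst (_< n) (sym (Finₚ.toℕ-inject₁ i)) (Finₚ.toℕ<n i)
    update⇔ : ∀ r t → Holds (cons (inject₁ i) t) (update r op) ⇔ Meaning w′ r t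
    update⇔ factorsᴿ   t = UpdateCorrectness.factorsUpdate-correct A (cons (inject₁ i) t) zero U i<n op refl (# 1) (# 2) (# 3) (# 4)
    update⇔ markedᴿ    t = UpdateCorrectness.markedUpdate-correct A (cons (inject₁ i) t) zero U i<n op refl (# 1)
    update⇔ succᴿ      t = ⇔-id _
    update⇔ distinctᴿ  t = ⇔-id _
    update⇔ insCaseᴿ   t = ⇔-id _
    update⇔ resetCaseᴿ t = ⇔-id _
    update⇔ markCaseᴿ  t = ⇔-id _
    update⇔ outputᴿ    t = OutputCorrectness.outputUpdate-correct A U i<n op refl t

  reachable-invariant : ∀ {w A} → Reachable (program {k}) n w A → Invariant w A
  reachable-invariant start               = initial-invariant
  reachable-invariant (step reach op i _) = step-invariant (reachable-invariant reach) op i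

lemma3p7 : (k : ℕ) → Σ (DynCQProgram k) (λ P → Maintains P Req)
lemma3p7 k = program , λ n w A reach t → reachable-invariant reach outputᴿ t ⇔-∘ ⇔-sym T-≡
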